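{- Let $p$ be a prime and let $R=R_1\times\cdots\times R_d$ where each $R_i$ is a finite commutative local ring, with $-1\in (R^{\times})^p$. Suppose that there is at most one index $i$ such that $2\notin R_i^{\times}$. Then $G_R(p)$ is connected if and only if $G_{R_i}(p)$ is connected for all $1\le i\le d$.
   Context: For a finite commutative ring $S$, $(S^{\times})^p=\{u^p:u\in S^{\times}\}$; it is assumed throughout that $-1$ lies in it. $G_S(p)$ is the simple undirected graph with vertex set $S$ in which $a,b$ are adjacent iff $a-b\in (S^{\times})^p$. -}

module Defs where

open import Level using (Level; _⊔_) renaming (suc to lsuc)
open import Algebra.Bundles using (CommutativeRing; Semiring)
open import Data.Nat using (ℕ)
open import Data.Fin using (Fin)
open import Data.Product using (Σ; _×_; _,_; ∃)
open import Relation.Nullary using (¬_)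
open import Relation.Binary.PropositionalEquality using () renaming (setoid to ≡-setoid)
open import Function.Bundles using (Inverse)
import Algebra.Definitions.RawSemiring as RS

private
  variable
    c ℓ : Level

module _ {d : ℕ} (R : Fin d → CommutativeRing c ℓ) where
  private
    module M (i : Fin d) = CommutativeRing (R i)

  productRing : CommutativeRing c ℓ
  productRing = record
    { Carrier = (i : Fin d) → M.Carrier i
    ; _≈_ = λ f g → ∀ i → M._≈_ i (f i) (g i)
    ; _+_ = λ f g i → M._+_ i (f i) (g i)
    ; _*_ = λ f g i → M._*_ i (f i) (g i)
    ; -_ = λ f i → M.-_ i (f i)
    ; 0# = λ i → M.0# i
    ; 1# = λ i → M.1# i
    ; isCommutativeRing = record
      { isRing = record
        { +-isAbelianGroup = record
          { isGroup = record
            { isMonoid = record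
              { isSemigroup = record
                { isMagma = record
                  { isEquivalence = record
                    { refl = λ i → M.refl i
                    ; sym = λ p i → M.sym i (p i)
                    ; trans = λ p q i → M.trans i (p i) (q i)
                    }
                  ; ∙-cong = λ p q i → M.+-cong i (p i) (q i)
                  }
                ; assoc = λ f g h i → M.+-assoc i (f i) (g i) (h i)
                }
              ; identity = (λ f i → M.+-identityˡ i (f i)) , (λ f i → M.+-identityʳ i (f i))
              }
            ; inverse = (λ f i → M.-‿inverseˡ i (f i)) , (λ f i → M.-‿inverseʳ i (f i))
            ; ⁻¹-cong = λ p i → M.-‿cong i (p i)
            }
          ; comm = λ f g i → M.+-comm i (f i) (g i)
          }
        ; *-cong = λ p q i → M.*-cong i (p i) (q i)
        ; *-assoc = λ f g h i → M.*-assoc i (f i) (g i) (h i)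
        ; *-identity = (λ f i → M.*-identityˡ i (f i)) , (λ f i → M.*-identityʳ i (f i))
        ; distrib = (λ f g h i → M.distribˡ i (f i) (g i) (h i)) , (λ f g h i → M.distribʳ i (f i) (g i) (h i))
        }
      ; *-comm = λ f g i → M.*-comm i (f i) (g i)
      }
    }

module _ (S : CommutativeRing c ℓ) where
  open CommutativeRing S
  open RS (Semiring.rawSemiring semiring) using (_^_)

  Finite : Set (c ⊔ ℓ)
  Finite = Σ ℕ λ n → Inverse (≡-setoid (Fin n)) setoid

  record Ideal : Set (lsuc (c ⊔ ℓ)) where
    field
      mem   : Carrier → Set (c ⊔ ℓ)
      resp  : ∀ {x y} → x ≈ y → mem x → mem y
      0∈    : mem 0#
      +-cl  : ∀ {x y} → mem x → mem y → mem (x + y)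
      *-cl  : ∀ r {x} → mem x → mem (r * x)

  open Ideal

  _⊆I_ : Ideal → Ideal → Set (c ⊔ ℓ)
  I ⊆I J = ∀ x → mem I x → mem J x

  Proper : Ideal → Set (c ⊔ ℓ)
  Proper I = ¬ mem I 1#

  Maximal : Ideal → Set (lsuc (c ⊔ ℓ))
  Maximal I = Proper I × (∀ J → I ⊆I J → Proper J → J ⊆I I)

  IsLocal : Set (lsuc (c ⊔ ℓ))
  IsLocal = Σ Ideal λ M → Maximal M × (∀ J → Maximal J → (J ⊆I M × M ⊆I J))

  IsUnit : Carrier → Set (c ⊔ ℓ)
  IsUnit u = ∃ λ v → u * v ≈ 1#

  InUnitPowers : ℕ → Carrier → Set (c ⊔ ℓ)
  InUnitPowers p x = ∃ λ u → IsUnit u × (x ≈ u ^ p)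

  -- the graph G_S(p): a ~ b iff a - b ∈ (S^×)^p
  Adj : ℕ → Carrier → Carrier → Set (c ⊔ ℓ)
  Adj p a b = InUnitPowers p (a - b)

  data Walk (p : ℕ) : Carrier → Carrier → Set (c ⊔ ℓ) where
    here : ∀ {a b} → a ≈ b → Walk p a b
    step : ∀ {a b e} → Adj p a b → Walk p b e → Walk p a e

  -- G_S(p) is connected (S is nonempty since it contains 0#)
  Connected : ℕ → Set (c ⊔ ℓ)
  Connected p = ∀ a b → Walk p a b

{-# OPTIONS --safe #-}
module Submission where

-- Projecting walks of G_R(p) to the factors gives one direction. Conversely, a
-- walk in the product is the same thing as walks of one common length in all
-- factors. As 1 and -1 are p-th powers of units, x → x - 1 → x is a closed walk
-- of length 2, so the lengths of walks between two vertices are closed under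
-- adding 2. If 2 is a unit, write v = 1/2 and take a walk 0 → v of length m; its
-- translates give the closed walk 0 → -1 → -1 + v → -1 + 2v = 0 of odd length
-- 2m + 1, so walks of every sufficiently large length exist. The one factor in
-- which 2 may fail to be a unit has walks of lengths n, n + 2, n + 4, …, which
-- eventually lie beyond the thresholds of all other factors.

open import Defs
open import Level using (Level; _⊔_)
open import Algebra.Bundles using (CommutativeRing; Semiring)
open import Data.Nat as Nat using (ℕ; zero; suc; _≤_)
open import Data.Nat.Properties using (+-suc; m∸n+n≡m; ≤-refl; ≤-trans; m≤m⊔n; m≤n⊔m; m≤m+n; m≤n+m)
open import Data.Nat.Primality using (Prime)
open import Data.Fin as Fin using (Fin) renaming (_≟_ to _≟ᶠ_)
open import Data.Fin.Properties using (any?; all?; ¬∀⟶∃¬)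
open import Data.Product using (_×_; ∃; _,_; proj₁; proj₂)
open import Data.Empty using (⊥-elim)
open import Function.Bundles using (_⇔_; mk⇔; Inverse)
open import Function.Properties.Inverse using (Inverse⇒Injection) renaming (sym to Inverse-sym)
open import Relation.Nullary using (¬_; Dec; yes; no)
open import Relation.Binary.Definitions using (Decidable)
open import Relation.Nullary.Decidable using (map′; via-injection)
open import Relation.Binary.PropositionalEquality as ≡ using (_≡_)
import Algebra.Definitions.RawSemiring as RawSemiring
import Algebra.Properties.AbelianGroup as AbelianGroupProperties
import Algebra.Properties.CommutativeSemigroup as CommutativeSemigroupProperties
import Relation.Binary.Reasoning.Setoid as SetoidReasoning

private
  variable
    c ℓ ℓ₁ ℓ₂ : Level

module _ where
  open import Data.Nat using (_+_)

  Eventually : (ℕ → Set ℓ₁) → Set ℓ₁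
  Eventually P = ∃ λ K → ∀ {N} → K ≤ N → P N

  Closed+2 : (ℕ → Set ℓ₁) → Set ℓ₁
  Closed+2 P = ∀ n → P n → P (2 + n)

  module _ {P : ℕ → Set ℓ₁} (+2 : Closed+2 P) where

    closed+2⇒closed+even : ∀ m {n} → P n → P (m + m + n)
    closed+2⇒closed+even zero    Pn = Pn
    closed+2⇒closed+even (suc m) {n} Pn =
      ≡.subst P (≡.cong (λ k → suc k + n) (≡.sym (+-suc m m))) (+2 _ (closed+2⇒closed+even m Pn))

    closed+2⇒eventually : ∀ {K} → P K → P (suc K) → Eventually P
    closed+2⇒eventually {K} PK PsK = K , λ K≤N → ≡.subst P (m∸n+n≡m K≤N) (from-K _)
      where
      from-K : ∀ j → P (j + K)
      from-K zero          = PK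
      from-K (suc zero)    = PsK
      from-K (suc (suc j)) = +2 _ (from-K j)

  eventually-∀ : ∀ {d} {P : Fin d → ℕ → Set ℓ₁} → (∀ i → Eventually (P i)) → Eventually (λ N → ∀ i → P i N)
  eventually-∀ {d = zero}  _  = 0 , λ _ ()
  eventually-∀ {d = suc d} ev with ev Fin.zero | eventually-∀ (λ i → ev (Fin.suc i))
  ... | K₀ , P₀ | K , Pₛ = K₀ Nat.⊔ K , λ where
    K₀⊔K≤N Fin.zero    → P₀ (≤-trans (m≤m⊔n K₀ K) K₀⊔K≤N)
    K₀⊔K≤N (Fin.suc i) → Pₛ (≤-trans (m≤n⊔m K₀ K) K₀⊔K≤N) i

  module _ {d} (P : Fin d → ℕ → Set ℓ₁) {Good : Fin d → Set ℓ₂} (good? : ∀ i → Dec (Good i)) where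

    eventually-∀-good : (∀ i → Good i → Eventually (P i)) → Eventually (λ N → ∀ i → Good i → P i N)
    eventually-∀-good good⇒eventually = eventually-∀ eventually-if-good
      where
      eventually-if-good : ∀ i → Eventually (λ N → Good i → P i N)
      eventually-if-good i with good? i
      ... | yes good = let K , large = good⇒eventually i good in K , λ K≤N _ → large K≤N
      ... | no bad   = 0 , λ _ good → ⊥-elim (bad good)

    -- An index outside Good gets the witness n₀ + 2K, beyond the threshold K of all others.
    common-witness : (∀ i j → ¬ Good i → ¬ Good j → i ≡ j)
      → (∀ i → ∃ (P i)) → (∀ i → Closed+2 (P i)) → (∀ i → Good i → Eventually (P i))
      → ∃ λ N → ∀ i → P i N
    common-witness bad-unique inhabited +2 good⇒eventually
      with eventually-∀-good good⇒eventually | all? good?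
    ... | K , large | yes all-good = K , λ i → large ≤-refl i (all-good i)
    ... | K , large | no ¬all-good with ¬∀⟶∃¬ d Good good? ¬all-good
    ... | i₀ , bad₀ with inhabited i₀
    ... | n₀ , P-n₀ = K + K + n₀ , P-at
      where
      P-at : ∀ i → P i (K + K + n₀)
      P-at i with good? i
      ... | yes good = large (≤-trans (m≤n+m K K) (m≤m+n (K + K) n₀)) i good
      ... | no bad   = ≡.subst (λ j → P j (K + K + n₀)) (bad-unique i₀ i bad₀ bad)
                         (closed+2⇒closed+even (+2 i₀) K P-n₀)

module _ (S : CommutativeRing c ℓ) (p : ℕ) where
  open CommutativeRing S

  data WalkOfLength : ℕ → Carrier → Carrier → Set (c ⊔ ℓ) where
    here : ∀ {a b} → a ≈ b → WalkOfLength 0 a b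
    step : ∀ {n a b e} → Adj S p a b → WalkOfLength n b e → WalkOfLength (suc n) a e

module _ {S : CommutativeRing c ℓ} {p : ℕ} where
  open CommutativeRing S
  open RawSemiring (Semiring.rawSemiring semiring) using (_^_)
  open AbelianGroupProperties +-abelianGroup using (⁻¹-∙-comm; ⁻¹-involutive; ε⁻¹≈ε)
  open CommutativeSemigroupProperties +-commutativeSemigroup using (interchange)
  open SetoidReasoning setoid

  private
    variable
      n m : ℕ
      a a′ b b′ e : Carrier

  walk⇒walkOfLength : Walk S p a b → ∃ λ n → WalkOfLength S p n a b
  walk⇒walkOfLength (here a≈b) = 0 , here a≈b
  walk⇒walkOfLength (step a~b w) = let n , w′ = walk⇒walkOfLength w in suc n , step a~b w′

  walkOfLength⇒walk : WalkOfLength S p n a b → Walk S p a b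
  walkOfLength⇒walk (here a≈b)   = here a≈b
  walkOfLength⇒walk (step a~b w) = step a~b (walkOfLength⇒walk w)

  walkOfLength-0⇒≈ : WalkOfLength S p 0 a b → a ≈ b
  walkOfLength-0⇒≈ (here a≈b) = a≈b

  second : WalkOfLength S p (suc n) a b → Carrier
  second (step {b = b} _ _) = b

  first-step : (w : WalkOfLength S p (suc n) a b) → Adj S p a (second w)
  first-step (step a~b _) = a~b

  tail : (w : WalkOfLength S p (suc n) a b) → WalkOfLength S p n (second w) b
  tail (step _ w) = w

  adj-resp : a ≈ a′ → b ≈ b′ → Adj S p a b → Adj S p a′ b′
  adj-resp a≈a′ b≈b′ (u , u∈S× , a-b≈uᵖ) = u , u∈S× , trans (sym (+-cong a≈a′ (-‿cong b≈b′))) a-b≈uᵖ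

  walkOfLength-resp : a ≈ a′ → b ≈ b′ → WalkOfLength S p n a b → WalkOfLength S p n a′ b′
  walkOfLength-resp a≈a′ b≈b′ (here a≈b)   = here (trans (sym a≈a′) (trans a≈b b≈b′))
  walkOfLength-resp a≈a′ b≈b′ (step a~c w) = step (adj-resp a≈a′ refl a~c) (walkOfLength-resp refl b≈b′ w)

  infixr 5 _++_
  _++_ : WalkOfLength S p m a b → WalkOfLength S p n b e → WalkOfLength S p (m Nat.+ n) a e
  here a≈b   ++ w′ = walkOfLength-resp (sym a≈b) refl w′
  step a~c w ++ w′ = step a~c (w ++ w′)

  x+a-[x+b]≈a-b : ∀ x a b → (x + a) - (x + b) ≈ a - b
  x+a-[x+b]≈a-b x a b = begin
    (x + a) - (x + b)      ≈⟨ +-congˡ (⁻¹-∙-comm x b) ⟨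
    (x + a) + (- x + - b)  ≈⟨ interchange x a (- x) (- b) ⟩
    (x - x) + (a - b)      ≈⟨ +-congʳ (-‿inverseʳ x) ⟩
    0# + (a - b)           ≈⟨ +-identityˡ (a - b) ⟩
    a - b                  ∎

  translate : ∀ x → WalkOfLength S p n a b → WalkOfLength S p n (x + a) (x + b)
  translate x (here a≈b) = here (+-congˡ a≈b)
  translate x (step (u , u∈S× , a-c≈uᵖ) w) =
    step (u , u∈S× , trans (x+a-[x+b]≈a-b x _ _) a-c≈uᵖ) (translate x w)

  closed-at-0⇒closed : WalkOfLength S p n 0# 0# → ∀ x → WalkOfLength S p n x x
  closed-at-0⇒closed w x = walkOfLength-resp (+-identityʳ x) (+-identityʳ x) (translate x w)

  1^n≈1 : ∀ n → 1# ^ n ≈ 1#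
  1^n≈1 zero    = refl
  1^n≈1 (suc n) = trans (*-congˡ (1^n≈1 n)) (*-identityˡ 1#)

  0~-1 : Adj S p 0# (- 1#)
  0~-1 = 1# , (1# , *-identityˡ 1#) , (begin
    0# - - 1#  ≈⟨ +-identityˡ (- - 1#) ⟩
    - - 1#     ≈⟨ ⁻¹-involutive 1# ⟩
    1#         ≈⟨ 1^n≈1 p ⟨
    1# ^ p     ∎)

  -1~0 : InUnitPowers S p (- 1#) → Adj S p (- 1#) 0#
  -1~0 (u , u∈S× , -1≈uᵖ) = u , u∈S× , trans (trans (+-congˡ ε⁻¹≈ε) (+-identityʳ (- 1#))) -1≈uᵖ

  walkOfLength-+2 : InUnitPowers S p (- 1#) → Closed+2 (λ n → WalkOfLength S p n a b)
  walkOfLength-+2 {a = a} -1∈S×ᵖ _ w = closed-at-0⇒closed (step 0~-1 (step (-1~0 -1∈S×ᵖ) (here refl))) a ++ w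

  oddClosedWalk : Connected S p → IsUnit S (1# + 1#) → ∀ x → ∃ λ m → WalkOfLength S p (suc (m Nat.+ m)) x x
  oddClosedWalk connected (v , 2v≈1) x with walk⇒walkOfLength (connected 0# v)
  ... | m , 0→v = m , closed-at-0⇒closed (step 0~-1 (to-[-1+v] ++ to-0)) x
    where
    -1+v+v≈0 : (- 1# + v) + v ≈ 0#
    -1+v+v≈0 = begin
      (- 1# + v) + v           ≈⟨ +-assoc (- 1#) v v ⟩
      - 1# + (v + v)           ≈⟨ +-congˡ (+-cong (*-identityˡ v) (*-identityˡ v)) ⟨
      - 1# + (1# * v + 1# * v) ≈⟨ +-congˡ (distribʳ v 1# 1#) ⟨
      - 1# + (1# + 1#) * v     ≈⟨ +-congˡ 2v≈1 ⟩
      - 1# + 1#                ≈⟨ -‿inverseˡ 1# ⟩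
      0#                       ∎

    to-[-1+v] : WalkOfLength S p m (- 1#) (- 1# + v)
    to-[-1+v] = walkOfLength-resp (+-identityʳ (- 1#)) refl (translate (- 1#) 0→v)

    to-0 : WalkOfLength S p m (- 1# + v) 0#
    to-0 = walkOfLength-resp (+-identityʳ (- 1# + v)) -1+v+v≈0 (translate (- 1# + v) 0→v)

  walkOfLength-eventually : InUnitPowers S p (- 1#) → Connected S p → IsUnit S (1# + 1#)
    → ∀ a b → Eventually (λ n → WalkOfLength S p n a b)
  walkOfLength-eventually -1∈S×ᵖ connected 2∈S× a b
    with walk⇒walkOfLength (connected a b) | oddClosedWalk connected 2∈S× a
  ... | _ , a→b | m , a→a =
    closed+2⇒eventually +2 (closed+2⇒closed+even +2 m a→b) (a→a ++ a→b)
    where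
    +2 : Closed+2 (λ n → WalkOfLength S p n a b)
    +2 = walkOfLength-+2 -1∈S×ᵖ

module _ (S : CommutativeRing c ℓ) (finite : Finite S) where
  open CommutativeRing S
  open Inverse (proj₂ finite) using (to; from; strictlyInverseˡ)

  finite⇒≈-decidable : Decidable _≈_
  finite⇒≈-decidable = via-injection (Inverse⇒Injection (Inverse-sym (proj₂ finite))) _≟ᶠ_

  isUnit? : ∀ u → Dec (IsUnit S u)
  isUnit? u = map′ (λ (k , uk≈1) → to k , uk≈1)
                   (λ (v , uv≈1) → from v , trans (*-congˡ (strictlyInverseˡ v)) uv≈1)
                   (any? λ k → finite⇒≈-decidable (u * to k) 1#)

module _ {d : ℕ} (R : Fin d → CommutativeRing c ℓ) (p : ℕ) where
  private
    module Π = CommutativeRing (productRing R)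
    module Rᵢ (i : Fin d) = CommutativeRing (R i)
    open RawSemiring (Semiring.rawSemiring Π.semiring) using () renaming (_^_ to _^Π_)

  ^-pointwise : ∀ u n i → (u ^Π n) i ≡ RawSemiring._^_ (Semiring.rawSemiring (Rᵢ.semiring i)) (u i) n
  ^-pointwise u zero    i = ≡.refl
  ^-pointwise u (suc n) i = ≡.cong (Rᵢ._*_ i (u i)) (^-pointwise u n i)

  unitPowers-proj : ∀ {x} → InUnitPowers (productRing R) p x → ∀ i → InUnitPowers (R i) p (x i)
  unitPowers-proj (u , (v , uv≈1) , x≈uᵖ) i =
    u i , (v i , uv≈1 i) , Rᵢ.trans i (x≈uᵖ i) (Rᵢ.reflexive i (^-pointwise u p i))

  unitPowers-tabulate : ∀ {x} → (∀ i → InUnitPowers (R i) p (x i)) → InUnitPowers (productRing R) p x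
  unitPowers-tabulate xᵢ∈Rᵢ×ᵖ = u , (v , uv≈1) , x≈uᵖ
    where
    u v : Π.Carrier
    u i = proj₁ (xᵢ∈Rᵢ×ᵖ i)
    v i = proj₁ (proj₁ (proj₂ (xᵢ∈Rᵢ×ᵖ i)))
    uv≈1 : u Π.* v Π.≈ Π.1#
    uv≈1 i = proj₂ (proj₁ (proj₂ (xᵢ∈Rᵢ×ᵖ i)))
    x≈uᵖ : _ Π.≈ u ^Π p
    x≈uᵖ i = Rᵢ.trans i (proj₂ (proj₂ (xᵢ∈Rᵢ×ᵖ i))) (Rᵢ.reflexive i (≡.sym (^-pointwise u p i)))

  walk-proj : ∀ {a b} → Walk (productRing R) p a b → ∀ i → Walk (R i) p (a i) (b i)
  walk-proj (here a≈b)   i = here (a≈b i)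
  walk-proj (step a~c w) i = step (unitPowers-proj a~c i) (walk-proj w i)

  walkOfLength-tabulate : ∀ n {a b} → (∀ i → WalkOfLength (R i) p n (a i) (b i))
    → WalkOfLength (productRing R) p n a b
  walkOfLength-tabulate zero    ws = here (λ i → walkOfLength-0⇒≈ (ws i))
  walkOfLength-tabulate (suc n) ws =
    step (unitPowers-tabulate (λ i → first-step (ws i))) (walkOfLength-tabulate n (λ i → tail (ws i)))

  embed : (i : Fin d) → Rᵢ.Carrier i → Π.Carrier
  embed i x j with i ≟ᶠ j
  ... | yes ≡.refl = x
  ... | no _       = Rᵢ.0# j

  embed-diag : ∀ i x → embed i x i ≡ x
  embed-diag i x with i ≟ᶠ i
  ... | yes ≡.refl = ≡.refl
  ... | no i≢i     = ⊥-elim (i≢i ≡.refl)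

  connected-proj : Connected (productRing R) p → ∀ i → Connected (R i) p
  connected-proj connected i a b =
    ≡.subst₂ (Walk (R i) p) (embed-diag i a) (embed-diag i b) (walk-proj (connected (embed i a) (embed i b)) i)

proposition5p7 : ∀ {c ℓ : Level} (p : ℕ) → Prime p → (d : ℕ)
    → (R : Fin d → CommutativeRing c ℓ)
    → (∀ i → Finite (R i) × IsLocal (R i))
    → InUnitPowers (productRing R) p (CommutativeRing.-_ (productRing R) (CommutativeRing.1# (productRing R)))
    → (∀ i j → ¬ IsUnit (R i) (CommutativeRing._+_ (R i) (CommutativeRing.1# (R i)) (CommutativeRing.1# (R i)))
             → ¬ IsUnit (R j) (CommutativeRing._+_ (R j) (CommutativeRing.1# (R j)) (CommutativeRing.1# (R j)))
             → i ≡ j)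
    → Connected (productRing R) p ⇔ (∀ i → Connected (R i) p)
proposition5p7 p _ d R finite×local -1∈R×ᵖ 2∉R×-unique = mk⇔ (connected-proj R p) connected
  where
  connected : (∀ i → Connected (R i) p) → Connected (productRing R) p
  connected Rᵢ-connected a b =
    walkOfLength⇒walk (walkOfLength-tabulate R p _ (proj₂ common-length))
    where
    common-length : ∃ λ n → ∀ i → WalkOfLength (R i) p n (a i) (b i)
    common-length =
      common-witness (λ i n → WalkOfLength (R i) p n (a i) (b i))
        (λ i → isUnit? (R i) (proj₁ (finite×local i)) _)
        2∉R×-unique
        (λ i → walk⇒walkOfLength (Rᵢ-connected i (a i) (b i)))
        (λ i → walkOfLength-+2 (unitPowers-proj R p -1∈R×ᵖ i))
        (λ i 2∈R× → walkOfLength-eventually (unitPowers-proj R p -1∈R×ᵖ i) (Rᵢ-connected i) 2∈R× (a i) (b i))
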